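{- Let $n\ge 2$. A permutation $\pi\in S_n$ is an arc permutation if and only if $$\pi = c_{n-1}^{k_{n-1}}c_{n-2}^{k_{n-2}}\cdots c_{1}^{k_{1}}$$ with $0\le k_{n-1}\le n-1$ and $k_i\in\{0,i\}$ for all $1\le i\le n-2$.
   Context: An interval of $\mathbb{Z}_n$ is a set of the form $\{a,a+1,\dots,b\}$ or $\{b,\dots,n,1,\dots,a\}$ with $1\le a\le b\le n$; $\pi\in S_n$ is an arc permutation if for every $1\le j\le n$ the set $\{\pi(1),\dots,\pi(j)\}$ is an interval of $\mathbb{Z}_n$. Permutations are functions multiplied by composition ($(\sigma\tau)(x)=\sigma(\tau(x))$). For $1\le m<n$, $c_m=\sigma_m\sigma_{m-1}\cdots\sigma_1$ where $\sigma_i$ is the transposition $(i,i+1)$; i.e. $c_m$ is the cycle $(m+1,m,\dots,2,1)$: $c_m(1)=m+1$, $c_m(j)=j-1$ for $2\le j\le m+1$, $c_m(j)=j$ for $j>m+1$. Every $\pi\in S_n$ has a unique expression $\pi=c_{n-1}^{k_{n-1}}\cdots c_1^{k_1}$ with $0\le k_i\le i$. -}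

module Defs where

open import Data.Nat using (ℕ; zero; suc; _+_; _∸_; _≤_; _<_)
open import Data.Nat.Properties using (_≟_; _<?_)
open import Data.Fin using (Fin; toℕ)
open import Data.Product using (Σ; ∃; _×_; _,_)
open import Data.Sum using (_⊎_)
open import Function using (_∘_; id)
open import Relation.Nullary using (yes; no)
open import Relation.Binary.PropositionalEquality using (_≡_)
open import Data.Fin.Permutation using (Permutation′; _⟨$⟩ʳ_)

-- Convention: the element i ∈ {1,…,n} of the paper is represented by
-- (y : Fin n) with toℕ y + 1 = i.  We work with the 1-based value
--   val y = toℕ y + 1.

val : ∀ {n} → Fin n → ℕ
val y = suc (toℕ y)

IsInterval : (n : ℕ) → (Fin n → Set) → Set
IsInterval n S =
  Σ ℕ λ a → Σ ℕ λ b → (1 ≤ a) × (a ≤ b) × (b ≤ n) ×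
    ((∀ y → S y → (a ≤ val y × val y ≤ b)) × (∀ y → (a ≤ val y × val y ≤ b) → S y)
    ⊎ (∀ y → S y → (b ≤ val y ⊎ val y ≤ a)) × (∀ y → (b ≤ val y ⊎ val y ≤ a) → S y))

prefixImage : ∀ {n} → Permutation′ n → ℕ → Fin n → Set
prefixImage {n} π j y = Σ (Fin n) λ x → (val x ≤ j) × (π ⟨$⟩ʳ x ≡ y)

IsArc : ∀ {n} → Permutation′ n → Set
IsArc {n} π = ∀ j → 1 ≤ j → j ≤ n → IsInterval n (prefixImage π j)

cℕ : ℕ → ℕ → ℕ
cℕ m j with j ≟ 1
... | yes _ = suc m
... | no _ with j <? suc (suc m)
...   | yes _ = j ∸ 1
...   | no _ = j

iter : ℕ → (ℕ → ℕ) → ℕ → ℕ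
iter zero f = id
iter (suc k) f = f ∘ iter k f

-- The product c_{n-1}^{k_{n-1}} c_{n-2}^{k_{n-2}} ⋯ c_1^{k_1} as a function on
-- values (composition: rightmost factor c_1^{k_1} is applied first).
-- cprod k m = c_m^{k m} ∘ ⋯ ∘ c_1^{k 1}.
cprod : (ℕ → ℕ) → ℕ → ℕ → ℕ
cprod k zero = id
cprod k (suc m) = iter (k (suc m)) (cℕ (suc m)) ∘ cprod k m

module Submission where

-- Permutations are handled through their value functions ℕ → ℕ on {1,…,n}.  The cycle
-- c_M acts on {1,…,M+1} as the rotation w ↦ w - 1 (1 ↦ M+1), whose inverse is rot⁺;
-- so powers of c_M carry intervals of ℤ_{M+1} to intervals of ℤ_{M+1} (cyc-iter).
-- "If": by induction on m, all prefix images of c_m^{k_m} ⋯ c_1^{k_1} with k_i ∈ {0, i}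
-- are ordinary intervals (prefix-intervals), and prepending any power of c_{n-1}
-- keeps them intervals of ℤ_n (glue).
-- "Only if": for a bijection f of {1,…,M+1} with p = f (M+1), τ = c_M^p ∘ f fixes M+1,
-- f = c_M^{M+1-p} ∘ τ, and the prefix images of τ are intervals of ℤ_{M+1} avoiding
-- M+1, i.e. ordinary intervals of {1,…,M} (peel).  If the prefix images of f are
-- ordinary intervals, then so is the set of all values but p, forcing p ∈ {1, M+1},
-- i.e. exponent M or 0; recursion gives the factorization.

open import Defs
open import Data.Nat using (ℕ; zero; suc; _+_; _∸_; _≤_; _<_; z≤n; s≤s; s≤s⁻¹)
open import Data.Nat.Properties
  using (_≟_; _<?_; ≤-refl; ≤-trans; ≤-reflexive; ≤-antisym; <-irrefl; <-trans; <-≤-trans;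
         <⇒≤; ≤∧≢⇒<; n≤1+n; n<1+n; m≤n⇒m≤1+n; m≤n⇒m<n∨m≡n; m≤m+n; m<m+n; suc-injective;
         +-identityʳ; +-suc; +-comm; +-cancelʳ-≡; m+[n∸m]≡n; m∸n+n≡m)
open import Data.Product using (Σ; _×_; _,_; proj₁; proj₂)
open import Data.Sum using (_⊎_; inj₁; inj₂)
import Data.Sum as Sum
open import Data.Empty using (⊥-elim)
open import Data.Fin using (Fin; toℕ; fromℕ<)
import Data.Fin.Properties as Fin
open import Data.Fin.Permutation using (Permutation′; _⟨$⟩ʳ_; _⟨$⟩ˡ_; inverseˡ; inverseʳ)
open import Function using (_∘_; id)
open import Function.Bundles using (_⇔_; mk⇔; Equivalence)
import Function.Properties.Equivalence as ⇔
open import Relation.Nullary using (¬_; yes; no)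
open import Relation.Binary.PropositionalEquality
  using (_≡_; _≢_; refl; sym; trans; cong; cong₂; subst; module ≡-Reasoning)

open Equivalence using (to; from)

≤-top : ∀ {i N} → i ≤ suc N → i ≤ N ⊎ i ≡ suc N
≤-top le = Sum.map₁ s≤s⁻¹ (m≤n⇒m<n∨m≡n le)

-- The successor rotation of {1,…,n}: w ↦ w + 1 for w < n and n ↦ 1.
-- It is the inverse of the cycle cℕ (n - 1).
rot⁺ : ℕ → ℕ → ℕ
rot⁺ n w with w <? n
... | yes _ = suc w
... | no _ = 1

rot⁺-< : ∀ {n w} → w < n → rot⁺ n w ≡ suc w
rot⁺-< {n} {w} w<n with w <? n
... | yes _ = refl
... | no w≮n = ⊥-elim (w≮n w<n)

rot⁺-last : ∀ n → rot⁺ n n ≡ 1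
rot⁺-last n with n <? n
... | yes n<n = ⊥-elim (<-irrefl refl n<n)
... | no _ = refl

rot⁺-range : ∀ {n w} → 1 ≤ w → w ≤ n → 1 ≤ rot⁺ n w × rot⁺ n w ≤ n
rot⁺-range {n} {w} 1≤w w≤n with m≤n⇒m<n∨m≡n w≤n
... | inj₁ w<n rewrite rot⁺-< w<n = s≤s z≤n , w<n
... | inj₂ refl rewrite rot⁺-last n = ≤-refl , ≤-trans 1≤w w≤n

c-pred : ∀ {M} u → u < M → cℕ M (suc (suc u)) ≡ suc u
c-pred {M} u u<M with suc (suc u) <? suc (suc M)
... | yes _ = refl
... | no ≮ = ⊥-elim (≮ (s≤s (s≤s u<M)))

c-fix : ∀ {M} v → suc M < v → cℕ M v ≡ v
c-fix (suc zero) (s≤s ())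
c-fix {M} (suc (suc u)) M+1<v with suc (suc u) <? suc (suc M)
... | yes v<M+2 = ⊥-elim (<-irrefl refl (≤-trans v<M+2 M+1<v))
... | no _ = refl

c-range : ∀ {M v} → 1 ≤ v → v ≤ suc M → 1 ≤ cℕ M v × cℕ M v ≤ suc M
c-range {M} {suc zero} _ _ = s≤s z≤n , ≤-refl
c-range {M} {suc (suc u)} _ v≤ rewrite c-pred u (s≤s⁻¹ v≤) = s≤s z≤n , m≤n⇒m≤1+n (s≤s⁻¹ v≤)

c∘rot⁺ : ∀ {M w} → 1 ≤ w → w ≤ suc M → cℕ M (rot⁺ (suc M) w) ≡ w
c∘rot⁺ {M} {w} 1≤w w≤ with m≤n⇒m<n∨m≡n w≤
c∘rot⁺ {M} {suc u} _ _ | inj₁ w<M+1 rewrite rot⁺-< w<M+1 = c-pred u (s≤s⁻¹ w<M+1)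
c∘rot⁺ {M} {w} _ _ | inj₂ refl rewrite rot⁺-last (suc M) = refl

rot⁺∘c : ∀ {M v} → 1 ≤ v → v ≤ suc M → rot⁺ (suc M) (cℕ M v) ≡ v
rot⁺∘c {M} {suc zero} _ _ = rot⁺-last (suc M)
rot⁺∘c {M} {suc (suc u)} _ v≤ rewrite c-pred u (s≤s⁻¹ v≤) = rot⁺-< (s≤s (s≤s⁻¹ v≤))

iter-+ : ∀ a b (f : ℕ → ℕ) x → iter (a + b) f x ≡ iter a f (iter b f x)
iter-+ zero b f x = refl
iter-+ (suc a) b f x = cong f (iter-+ a b f x)

iter-fix : ∀ {M} t v → suc M < v → iter t (cℕ M) v ≡ v
iter-fix zero v _ = refl
iter-fix (suc t) v lt = trans (cong (cℕ _) (iter-fix t v lt)) (c-fix v lt)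

iter-c-down : ∀ {M} t u → u + t ≤ M → iter t (cℕ M) (suc u + t) ≡ suc u
iter-c-down zero u _ rewrite +-identityʳ u = refl
iter-c-down {M} (suc t) u le rewrite +-suc u t =
  trans (cong (cℕ M) (iter-c-down t (suc u) le)) (c-pred u (<-≤-trans (s≤s (m≤m+n u t)) le))

-- p steps of c_M bring p to M + 1: down to 1 and then around.
c-pow-self : ∀ {M p} → 1 ≤ p → p ≤ suc M → iter p (cℕ M) p ≡ suc M
c-pow-self {M} {suc u} _ p≤ = cong (cℕ M) (iter-c-down u 0 (s≤s⁻¹ p≤))

c-period : ∀ {M w} → 1 ≤ w → w ≤ suc M → iter (suc M) (cℕ M) w ≡ w
c-period {M} {suc u} _ w≤ = begin
    iter (suc M) c (suc u)                ≡⟨ cong (λ t → iter t c (suc u)) (sym split) ⟩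
    iter ((M ∸ u) + suc u) c (suc u)      ≡⟨ iter-+ (M ∸ u) (suc u) c (suc u) ⟩
    iter (M ∸ u) c (iter (suc u) c (suc u)) ≡⟨ cong (iter (M ∸ u) c) (c-pow-self (s≤s z≤n) w≤) ⟩
    iter (M ∸ u) c (suc M)                ≡⟨ cong (iter (M ∸ u) c ∘ suc) (sym (m+[n∸m]≡n u≤M)) ⟩
    iter (M ∸ u) c (suc u + (M ∸ u))      ≡⟨ iter-c-down (M ∸ u) u (≤-reflexive (m+[n∸m]≡n u≤M)) ⟩
    suc u                                 ∎
  where
  open ≡-Reasoning
  c : ℕ → ℕ
  c = cℕ M
  u≤M : u ≤ M
  u≤M = s≤s⁻¹ w≤
  split : (M ∸ u) + suc u ≡ suc M
  split = trans (+-suc (M ∸ u) u) (cong suc (m∸n+n≡m u≤M))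

Img : (ℕ → ℕ) → ℕ → ℕ → Set
Img f j w = Σ ℕ λ i → 1 ≤ i × i ≤ j × f i ≡ w

record Bijective (N : ℕ) (f : ℕ → ℕ) : Set where
  field
    range : ∀ {i} → 1 ≤ i → i ≤ N → 1 ≤ f i × f i ≤ N
    injective : ∀ {i i′} → 1 ≤ i → i ≤ N → 1 ≤ i′ → i′ ≤ N → f i ≡ f i′ → i ≡ i′
    surjective : ∀ {w} → 1 ≤ w → w ≤ N → Img f N w

open Bijective

bij-id : ∀ {N} → Bijective N id
bij-id = record
  { range = _,_
  ; injective = λ _ _ _ _ e → e
  ; surjective = λ {w} a b → w , a , b , refl }

bij-∘ : ∀ {N g f} → Bijective N g → Bijective N f → Bijective N (g ∘ f)
bij-∘ {N} {g} {f} bg bf = record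
  { range = λ a b → range bg (proj₁ (range bf a b)) (proj₂ (range bf a b))
  ; injective = λ a b a′ b′ e → injective bf a b a′ b′
      (injective bg (proj₁ (range bf a b)) (proj₂ (range bf a b))
                    (proj₁ (range bf a′ b′)) (proj₂ (range bf a′ b′)) e)
  ; surjective = surj }
  where
  surj : ∀ {w} → 1 ≤ w → w ≤ N → Img (g ∘ f) N w
  surj a b with surjective bg a b
  ... | x , 1≤x , x≤N , gx≡w with surjective bf 1≤x x≤N
  ...   | i , 1≤i , i≤N , fi≡x = i , 1≤i , i≤N , trans (cong g fi≡x) gx≡w

bij-iter : ∀ {N g} t → Bijective N g → Bijective N (iter t g)
bij-iter zero _ = bij-id
bij-iter (suc t) bg = bij-∘ bg (bij-iter t bg)

bij-c : ∀ {M} → Bijective (suc M) (cℕ M)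
bij-c = record
  { range = c-range
  ; injective = λ a b a′ b′ e →
      trans (sym (rot⁺∘c a b)) (trans (cong (rot⁺ _) e) (rot⁺∘c a′ b′))
  ; surjective = λ {w} a b →
      rot⁺ _ w , proj₁ (rot⁺-range a b) , proj₂ (rot⁺-range a b) , c∘rot⁺ a b }

bij-restrict : ∀ {M τ} → Bijective (suc M) τ → τ (suc M) ≡ suc M → Bijective M τ
bij-restrict {M} {τ} bτ top = record
  { range = λ a b → proj₁ (range bτ a (m≤n⇒m≤1+n b)) , below a b
  ; injective = λ a b a′ b′ → injective bτ a (m≤n⇒m≤1+n b) a′ (m≤n⇒m≤1+n b′)
  ; surjective = surj }
  where
  not-top : ∀ {i} → 1 ≤ i → i ≤ M → τ i ≢ suc M
  not-top a b e =
    <-irrefl (injective bτ a (m≤n⇒m≤1+n b) (s≤s z≤n) ≤-refl (trans e (sym top))) (s≤s b)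
  below : ∀ {i} → 1 ≤ i → i ≤ M → τ i ≤ M
  below a b = s≤s⁻¹ (≤∧≢⇒< (proj₂ (range bτ a (m≤n⇒m≤1+n b))) (not-top a b))
  surj : ∀ {w} → 1 ≤ w → w ≤ M → Img τ M w
  surj {w} a b with surjective bτ a (m≤n⇒m≤1+n b)
  ... | i , 1≤i , i≤ , τi≡w with ≤-top i≤
  ...   | inj₁ i≤M = i , 1≤i , i≤M , τi≡w
  ...   | inj₂ refl = ⊥-elim (<-irrefl (trans (sym τi≡w) top) (s≤s b))

bij-extend : ∀ {M τ} → Bijective M τ → τ (suc M) ≡ suc M → Bijective (suc M) τ
bij-extend {M} {τ} bτ top = record { range = rng ; injective = inj ; surjective = surj }
  where
  rng : ∀ {i} → 1 ≤ i → i ≤ suc M → 1 ≤ τ i × τ i ≤ suc M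
  rng a b with ≤-top b
  ... | inj₁ i≤M = proj₁ (range bτ a i≤M) , m≤n⇒m≤1+n (proj₂ (range bτ a i≤M))
  ... | inj₂ refl rewrite top = s≤s z≤n , ≤-refl
  -- a value τ i with i ≤ M is at most M, hence differs from τ (M+1)
  apart : ∀ {i} → 1 ≤ i → i ≤ M → τ i ≢ τ (suc M)
  apart a b e = <-irrefl (trans e top) (s≤s (proj₂ (range bτ a b)))
  inj : ∀ {i i′} → 1 ≤ i → i ≤ suc M → 1 ≤ i′ → i′ ≤ suc M → τ i ≡ τ i′ → i ≡ i′
  inj a b a′ b′ e with ≤-top b | ≤-top b′
  ... | inj₁ i≤M | inj₁ i′≤M = injective bτ a i≤M a′ i′≤M e
  ... | inj₁ i≤M | inj₂ refl = ⊥-elim (apart a i≤M e)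
  ... | inj₂ refl | inj₁ i′≤M = ⊥-elim (apart a′ i′≤M (sym e))
  ... | inj₂ refl | inj₂ refl = refl
  surj : ∀ {w} → 1 ≤ w → w ≤ suc M → Img τ (suc M) w
  surj a b with ≤-top b
  ... | inj₁ w≤M = let i , 1≤i , i≤M , e = surjective bτ a w≤M in i , 1≤i , m≤n⇒m≤1+n i≤M , e
  ... | inj₂ refl = suc M , s≤s z≤n , ≤-refl , top

img-avoids-last : ∀ {N f j} → Bijective N f → j < N → ¬ Img f j (f N)
img-avoids-last {N} bf j<N (i , 1≤i , i≤j , e) =
  <-irrefl (injective bf 1≤i (<⇒≤ i<N) (≤-trans 1≤i (<⇒≤ i<N)) ≤-refl e) i<N
  where
  i<N : i < N
  i<N = <-≤-trans (s≤s i≤j) j<N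

-- Sets of values are predicates on ℕ; only their behaviour on {1,…,n} matters.
Agree : ℕ → (ℕ → Set) → (ℕ → Set) → Set
Agree n S T = ∀ {w} → 1 ≤ w → w ≤ n → S w ⇔ T w

agree-sym : ∀ {n S T} → Agree n S T → Agree n T S
agree-sym ag a b = ⇔.sym (ag a b)

agree-trans : ∀ {n S T U} → Agree n S T → Agree n T U → Agree n S U
agree-trans ST TU a b = ⇔.trans (ST a b) (TU a b)

Between : ℕ → ℕ → ℕ → Set
Between a b w = a ≤ w × w ≤ b

Wrap : ℕ → ℕ → ℕ → Set
Wrap a b w = b ≤ w ⊎ w ≤ a

data LinInterval (N : ℕ) (S : ℕ → Set) : Set where
  lin : ∀ a b → 1 ≤ a → a ≤ b → b ≤ N → Agree N S (Between a b) → LinInterval N S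

data CycInterval (n : ℕ) (S : ℕ → Set) : Set where
  straight : LinInterval n S → CycInterval n S
  wrapped : ∀ a b → 1 ≤ a → a ≤ b → b ≤ n → Agree n S (Wrap a b) → CycInterval n S

cyc-cong : ∀ {n S T} → Agree n S T → CycInterval n S → CycInterval n T
cyc-cong ST (straight (lin a b p q r ag)) = straight (lin a b p q r (agree-trans (agree-sym ST) ag))
cyc-cong ST (wrapped a b p q r ag) = wrapped a b p q r (agree-trans (agree-sym ST) ag)

rot⁺-agree : ∀ {n S T} → (∀ {w} → 1 ≤ w → w < n → S (suc w) ⇔ T w) → (S 1 ⇔ T n) →
             Agree n (S ∘ rot⁺ n) T
rot⁺-agree {n} step last {w} a b with m≤n⇒m<n∨m≡n b
... | inj₁ w<n rewrite rot⁺-< w<n = step a w<n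
... | inj₂ refl rewrite rot⁺-last n = last

agree-rot⁺ : ∀ {n S T} → Agree n S T → Agree n (S ∘ rot⁺ n) (T ∘ rot⁺ n)
agree-rot⁺ ag a b = ag (proj₁ (rot⁺-range a b)) (proj₂ (rot⁺-range a b))

rotate-between : ∀ {n a b} → 1 ≤ a → a ≤ b → b ≤ n → CycInterval n (Between a b ∘ rot⁺ n)
rotate-between {n} {suc zero} {suc zero} _ _ 1≤n =
  straight (lin n n 1≤n ≤-refl ≤-refl
    (rot⁺-agree {S = Between 1 1} step (mk⇔ (λ _ → ≤-refl , ≤-refl) (λ _ → ≤-refl , ≤-refl))))
  where
  step : ∀ {w} → 1 ≤ w → w < n → Between 1 1 (suc w) ⇔ Between n n w
  step (s≤s z≤n) w<n =
    mk⇔ (λ { (_ , s≤s ()) }) (λ (n≤w , _) → ⊥-elim (<-irrefl refl (<-≤-trans w<n n≤w)))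
rotate-between {n} {suc zero} {suc (suc b)} _ _ b+2≤n =
  wrapped (suc b) n (s≤s z≤n) (≤-trans (n≤1+n _) b+2≤n) ≤-refl
    (rot⁺-agree {S = Between 1 (suc (suc b))} step
                (mk⇔ (λ _ → inj₁ ≤-refl) (λ _ → ≤-refl , s≤s z≤n)))
  where
  step : ∀ {w} → 1 ≤ w → w < n → Between 1 (suc (suc b)) (suc w) ⇔ Wrap (suc b) n w
  step w≥1 w<n = mk⇔ (λ (_ , w+1≤) → inj₂ (s≤s⁻¹ w+1≤))
    (λ { (inj₁ n≤w) → ⊥-elim (<-irrefl refl (<-≤-trans w<n n≤w)) ; (inj₂ w≤) → s≤s z≤n , s≤s w≤ })
rotate-between {n} {suc (suc a)} {suc b} _ a≤b b≤n =
  straight (lin (suc a) b (s≤s z≤n) (s≤s⁻¹ a≤b) (≤-trans (n≤1+n b) b≤n)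
    (rot⁺-agree {S = Between (suc (suc a)) (suc b)}
                (λ _ _ → mk⇔ (λ (p , q) → s≤s⁻¹ p , s≤s⁻¹ q) (λ (p , q) → s≤s p , s≤s q))
                (mk⇔ (λ { (s≤s () , _) })
                     (λ (_ , n≤b) → ⊥-elim (<-irrefl refl (≤-trans b≤n n≤b))))))

rotate-wrap : ∀ {n a b} → 1 ≤ a → a ≤ b → b ≤ n → CycInterval n (Wrap a b ∘ rot⁺ n)
rotate-wrap {n} {suc zero} {suc zero} _ _ 1≤n =
  straight (lin 1 n ≤-refl 1≤n ≤-refl
    (rot⁺-agree {S = Wrap 1 1} (λ w≥1 w<n → mk⇔ (λ _ → w≥1 , <⇒≤ w<n) (λ _ → inj₁ (s≤s z≤n)))
                (mk⇔ (λ _ → 1≤n , ≤-refl) (λ _ → inj₂ ≤-refl))))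
rotate-wrap {n} {suc zero} {suc (suc b)} _ _ b+2≤n =
  straight (lin (suc b) n (s≤s z≤n) b+1≤n ≤-refl
    (rot⁺-agree {S = Wrap 1 (suc (suc b))} step (mk⇔ (λ _ → b+1≤n , ≤-refl) (λ _ → inj₂ ≤-refl))))
  where
  b+1≤n : suc b ≤ n
  b+1≤n = ≤-trans (n≤1+n _) b+2≤n
  step : ∀ {w} → 1 ≤ w → w < n → Wrap 1 (suc (suc b)) (suc w) ⇔ Between (suc b) n w
  step (s≤s z≤n) w<n = mk⇔ (λ { (inj₁ b+2≤w+1) → s≤s⁻¹ b+2≤w+1 , <⇒≤ w<n ; (inj₂ (s≤s ())) })
                           (λ (b+1≤w , _) → inj₁ (s≤s b+1≤w))
rotate-wrap {n} {suc (suc a)} {suc b} _ a≤b b≤n =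
  wrapped (suc a) b (s≤s z≤n) (s≤s⁻¹ a≤b) b′≤n
    (rot⁺-agree {S = Wrap (suc (suc a)) (suc b)}
                (λ _ _ → mk⇔ (Sum.map s≤s⁻¹ s≤s⁻¹) (Sum.map s≤s s≤s))
                (mk⇔ (λ _ → inj₁ b′≤n) (λ _ → inj₂ (s≤s z≤n))))
  where
  b′≤n : b ≤ n
  b′≤n = ≤-trans (n≤1+n b) b≤n

cyc-rot⁺ : ∀ {n S} → CycInterval n S → CycInterval n (S ∘ rot⁺ n)
cyc-rot⁺ (straight (lin a b p q r ag)) = cyc-cong (agree-sym (agree-rot⁺ ag)) (rotate-between p q r)
cyc-rot⁺ (wrapped a b p q r ag) = cyc-cong (agree-sym (agree-rot⁺ ag)) (rotate-wrap p q r)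

widen-top : ∀ {M S} → LinInterval M S → ¬ S (suc M) → LinInterval (suc M) S
widen-top {M} {S} (lin a b p q r ag) ¬top = lin a b p q (m≤n⇒m≤1+n r) ag′
  where
  ag′ : Agree (suc M) S (Between a b)
  ag′ x y with ≤-top y
  ... | inj₁ w≤M = ag x w≤M
  ... | inj₂ refl = mk⇔ (λ s → ⊥-elim (¬top s))
                        (λ (_ , M+1≤b) → ⊥-elim (<-irrefl refl (≤-trans M+1≤b r)))

narrow-top : ∀ {M S} → LinInterval (suc M) S → ¬ S (suc M) → LinInterval M S
narrow-top {M} (lin a b p q r ag) ¬top with ≤-top r
... | inj₁ b≤M = lin a b p q b≤M (λ x y → ag x (m≤n⇒m≤1+n y))
... | inj₂ refl = ⊥-elim (¬top (from (ag (≤-trans p q) ≤-refl) (q , ≤-refl)))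

-- A wrapped interval contains both 1 and n, so an interval missing 1 or n is straight.
cyc-missing-end : ∀ {n S} → CycInterval n S → ¬ S 1 ⊎ ¬ S n → LinInterval n S
cyc-missing-end (straight I) _ = I
cyc-missing-end (wrapped a b p q r ag) (inj₁ ¬S1) =
  ⊥-elim (¬S1 (from (ag ≤-refl (≤-trans p (≤-trans q r))) (inj₂ p)))
cyc-missing-end (wrapped a b p q r ag) (inj₂ ¬Sn) =
  ⊥-elim (¬Sn (from (ag (≤-trans p (≤-trans q r)) ≤-refl) (inj₁ r)))

gap-at-end : ∀ {N S p} → LinInterval N S → Agree N S (λ w → w ≢ p) → 1 ≤ p → p ≤ N →
             p ≡ 1 ⊎ p ≡ N
gap-at-end {p = suc zero} _ _ _ _ = inj₁ refl
gap-at-end {N} {p = suc (suc q)} (lin a b _ _ _ ag) gap 1≤p p≤N with suc (suc q) ≟ N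
... | yes p≡N = inj₂ p≡N
... | no p≢N = ⊥-elim (to (gap 1≤p p≤N) (from (ag 1≤p p≤N) (a≤p , p≤b)) refl)
  where
  -- both neighbours p - 1 and p + 1 lie in {1,…,N} and differ from p, so they are in S
  p-1≤N : suc q ≤ N
  p-1≤N = ≤-trans (n≤1+n _) p≤N
  p<N : suc (suc q) < N
  p<N = ≤∧≢⇒< p≤N p≢N
  a≤p : a ≤ suc (suc q)
  a≤p = ≤-trans (proj₁ (to (ag (s≤s z≤n) p-1≤N) (from (gap (s≤s z≤n) p-1≤N) (λ ())))) (n≤1+n _)
  p≤b : suc (suc q) ≤ b
  p≤b = ≤-trans (n≤1+n _) (proj₂ (to (ag (s≤s z≤n) p<N) (from (gap (s≤s z≤n) p<N) (λ ()))))

full-image : ∀ {N f} → Bijective N f → 1 ≤ N → LinInterval N (Img f N)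
full-image {N} bf 1≤N =
  lin 1 N ≤-refl 1≤N ≤-refl (λ a b → mk⇔ (λ _ → a , b) (λ _ → surjective bf a b))

img-but-last : ∀ {M f} → Bijective (suc M) f → Agree (suc M) (Img f M) (λ w → w ≢ f (suc M))
img-but-last {M} {f} bf {w} a b = mk⇔
  (λ (i , 1≤i , i≤M , e) e′ → img-avoids-last bf ≤-refl (i , 1≤i , i≤M , trans e e′))
  other
  where
  other : w ≢ f (suc M) → Img f M w
  other w≢ with surjective bf a b
  ... | i , 1≤i , i≤ , fi≡w with ≤-top i≤
  ...   | inj₁ i≤M = i , 1≤i , i≤M , fi≡w
  ...   | inj₂ refl = ⊥-elim (w≢ (sym fi≡w))

img-c : ∀ {M f j} → Bijective (suc M) f → j ≤ suc M →
        Agree (suc M) (Img (cℕ M ∘ f) j) (Img f j ∘ rot⁺ (suc M))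
img-c {M} {f} {j} bf j≤ a b = mk⇔
  (λ (i , 1≤i , i≤j , e) → i , 1≤i , i≤j ,
     trans (sym (rot⁺∘c (proj₁ (rng 1≤i i≤j)) (proj₂ (rng 1≤i i≤j)))) (cong (rot⁺ (suc M)) e))
  (λ (i , 1≤i , i≤j , e) → i , 1≤i , i≤j , trans (cong (cℕ M) e) (c∘rot⁺ a b))
  where
  rng : ∀ {i} → 1 ≤ i → i ≤ j → 1 ≤ f i × f i ≤ suc M
  rng 1≤i i≤j = range bf 1≤i (≤-trans i≤j j≤)

cyc-iter : ∀ {M f j} → Bijective (suc M) f → j ≤ suc M → CycInterval (suc M) (Img f j) →
           ∀ t → CycInterval (suc M) (Img (iter t (cℕ M) ∘ f) j)
cyc-iter bf j≤ I zero = I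
cyc-iter bf j≤ I (suc t) =
  cyc-cong (agree-sym (img-c (bij-∘ (bij-iter t bij-c) bf) j≤)) (cyc-rot⁺ (cyc-iter bf j≤ I t))

Admissible : ℕ → (ℕ → ℕ) → Set
Admissible m k = ∀ i → 1 ≤ i → i ≤ m → k i ≡ 0 ⊎ k i ≡ i

setAt : (ℕ → ℕ) → ℕ → ℕ → ℕ → ℕ
setAt k m x i with i ≟ m
... | yes _ = x
... | no _ = k i

setAt-same : ∀ k m x → setAt k m x m ≡ x
setAt-same k m x with m ≟ m
... | yes _ = refl
... | no m≢m = ⊥-elim (m≢m refl)

setAt-below : ∀ k m x {i} → i ≤ m → setAt k (suc m) x i ≡ k i
setAt-below k m x {i} i≤m with i ≟ suc m
... | yes refl = ⊥-elim (<-irrefl refl (s≤s i≤m))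
... | no _ = refl

admissible-pred : ∀ {m k} → Admissible (suc m) k → Admissible m k
admissible-pred adm i a b = adm i a (m≤n⇒m≤1+n b)

admissible-setAt-below : ∀ {m k x} → Admissible m k → Admissible m (setAt k (suc m) x)
admissible-setAt-below {m} {k} {x} adm i a b rewrite setAt-below k m x b = adm i a b

admissible-setAt : ∀ {m k x} → Admissible m k → x ≡ 0 ⊎ x ≡ suc m →
                   Admissible (suc m) (setAt k (suc m) x)
admissible-setAt {m} {k} {x} adm x-ok i a b with ≤-top b
... | inj₁ i≤m rewrite setAt-below k m x i≤m = adm i a i≤m
... | inj₂ refl rewrite setAt-same k (suc m) x = x-ok

cprod-fix : ∀ k m v → suc m < v → cprod k m v ≡ v
cprod-fix k zero v _ = refl
cprod-fix k (suc m) v lt =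
  trans (cong (iter (k (suc m)) (cℕ (suc m))) (cprod-fix k m v (<-trans (n<1+n (suc m)) lt)))
        (iter-fix {suc m} (k (suc m)) v lt)

cprod-ext : ∀ k k′ m → (∀ i → 1 ≤ i → i ≤ m → k i ≡ k′ i) → ∀ v → cprod k m v ≡ cprod k′ m v
cprod-ext k k′ zero _ v = refl
cprod-ext k k′ (suc m) same v =
  cong₂ (λ t w → iter t (cℕ (suc m)) w) (same (suc m) (s≤s z≤n) ≤-refl)
        (cprod-ext k k′ m (λ i a b → same i a (m≤n⇒m≤1+n b)) v)

cprod-setAt : ∀ k m K v →
              cprod (setAt k (suc m) K) (suc m) v ≡ iter K (cℕ (suc m)) (cprod k m v)
cprod-setAt k m K v rewrite setAt-same k (suc m) K =
  cong (iter K (cℕ (suc m))) (cprod-ext (setAt k (suc m) K) k m (λ i _ b → setAt-below k m K b) v)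

bij-cprod : ∀ k m → Bijective (suc m) (cprod k m)
bij-cprod k zero = bij-id
bij-cprod k (suc m) =
  bij-∘ (bij-iter (k (suc m)) bij-c)
        (bij-extend (bij-cprod k m) (cprod-fix k m (suc (suc m)) ≤-refl))

glue : ∀ {M τ} → Bijective M τ → τ (suc M) ≡ suc M →
       (∀ j → 1 ≤ j → j ≤ M → LinInterval M (Img τ j)) →
       ∀ K j → 1 ≤ j → j ≤ suc M → CycInterval (suc M) (Img (iter K (cℕ M) ∘ τ) j)
glue {M} {τ} bτ top lin-τ K j 1≤j j≤ = by-cases (≤-top j≤)
  where
  bτ′ : Bijective (suc M) τ
  bτ′ = bij-extend bτ top
  by-cases : j ≤ M ⊎ j ≡ suc M → CycInterval (suc M) (Img (iter K (cℕ M) ∘ τ) j)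
  by-cases (inj₁ j≤M) = cyc-iter bτ′ j≤ (straight (widen-top (lin-τ j 1≤j j≤M) avoid)) K
    where
    avoid : ¬ Img τ j (suc M)
    avoid = subst (¬_ ∘ Img τ j) top (img-avoids-last bτ′ (s≤s j≤M))
  by-cases (inj₂ refl) = straight (full-image (bij-∘ (bij-iter K bij-c) bτ′) (s≤s z≤n))

admissible-end : ∀ {k m} → k (suc m) ≡ 0 ⊎ k (suc m) ≡ suc m →
                 cprod k (suc m) (suc (suc m)) ≡ suc (suc m) ⊎ cprod k (suc m) (suc (suc m)) ≡ 1
admissible-end {k} {m} k-ok rewrite cprod-fix k m (suc (suc m)) ≤-refl with k-ok
... | inj₁ e rewrite e = inj₁ refl
... | inj₂ e rewrite e = inj₂ (iter-c-down (suc m) 0 ≤-refl)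

-- The full prefix is all of {1,…,m+1}; a shorter one is an interval of ℤ_{m+1} by glue
-- and the induction hypothesis, and it misses the end point 1 or m+1.
prefix-intervals : ∀ {k} m → Admissible m k →
                   ∀ j → 1 ≤ j → j ≤ suc m → LinInterval (suc m) (Img (cprod k m) j)
prefix-intervals {k} m adm j 1≤j j≤ with ≤-top j≤
... | inj₂ refl = full-image (bij-cprod k m) (s≤s z≤n)
prefix-intervals zero adm j 1≤j j≤ | inj₁ j≤0 = ⊥-elim (<-irrefl refl (≤-trans 1≤j j≤0))
prefix-intervals {k} (suc m) adm j 1≤j j≤ | inj₁ j≤m+1 =
  cyc-missing-end
    (glue (bij-cprod k m) (cprod-fix k m (suc (suc m)) ≤-refl)
          (prefix-intervals m (admissible-pred adm)) (k (suc m)) j 1≤j j≤)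
    misses-end
  where
  -- the first j ≤ m+1 values miss g (m+2), which is m+2 or 1
  g : ℕ → ℕ
  g = cprod k (suc m)
  avoid : ¬ Img g j (g (suc (suc m)))
  avoid = img-avoids-last (bij-cprod k (suc m)) (s≤s j≤m+1)
  misses-end : ¬ Img g j 1 ⊎ ¬ Img g j (suc (suc m))
  misses-end with admissible-end {k} (adm (suc m) (s≤s z≤n) ≤-refl)
  ... | inj₁ e = inj₂ (subst (¬_ ∘ Img g j) e avoid)
  ... | inj₂ e = inj₁ (subst (¬_ ∘ Img g j) e avoid)

-- For a bijection f of {1,…,M+1} put p = f (M+1),
-- K = M + 1 - p and τ = c_M^p ∘ f.
record Peeled (M : ℕ) (f : ℕ → ℕ) : Set where
  field
    K : ℕ
    τ : ℕ → ℕ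
    K+last : K + f (suc M) ≡ suc M
    τ-bij : Bijective M τ
    τ-top : τ (suc M) ≡ suc M
    τ-lin : ∀ j → 1 ≤ j → j ≤ M → LinInterval M (Img τ j)
    f≡cᴷτ : ∀ {v} → 1 ≤ v → v ≤ suc M → f v ≡ iter K (cℕ M) (τ v)

peel : ∀ {M f} → Bijective (suc M) f → (∀ j → 1 ≤ j → j ≤ M → CycInterval (suc M) (Img f j)) →
       Peeled M f
peel {M} {f} bf cyc-f = record
  { K = suc M ∸ p ; τ = τ ; K+last = m∸n+n≡m p≤ ; τ-bij = bij-restrict bτ τ-top
  ; τ-top = τ-top ; τ-lin = τ-lin ; f≡cᴷτ = f≡cᴷτ }
  where
  c : ℕ → ℕ
  c = cℕ M
  p : ℕ
  p = f (suc M)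
  1≤p : 1 ≤ p
  1≤p = proj₁ (range bf (s≤s z≤n) ≤-refl)
  p≤ : p ≤ suc M
  p≤ = proj₂ (range bf (s≤s z≤n) ≤-refl)
  τ : ℕ → ℕ
  τ = iter p c ∘ f
  bτ : Bijective (suc M) τ
  bτ = bij-∘ (bij-iter p bij-c) bf
  τ-top : τ (suc M) ≡ suc M
  τ-top = c-pow-self 1≤p p≤
  τ-lin : ∀ j → 1 ≤ j → j ≤ M → LinInterval M (Img τ j)
  τ-lin j 1≤j j≤M =
    narrow-top
      (cyc-missing-end (cyc-iter bf (m≤n⇒m≤1+n j≤M) (cyc-f j 1≤j j≤M) p) (inj₂ avoid)) avoid
    where
    avoid : ¬ Img τ j (suc M)
    avoid = subst (¬_ ∘ Img τ j) τ-top (img-avoids-last bτ (s≤s j≤M))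
  f≡cᴷτ : ∀ {v} → 1 ≤ v → v ≤ suc M → f v ≡ iter (suc M ∸ p) c (τ v)
  f≡cᴷτ {v} a b = sym (begin
    iter (suc M ∸ p) c (iter p c (f v)) ≡⟨ sym (iter-+ (suc M ∸ p) p c (f v)) ⟩
    iter (suc M ∸ p + p) c (f v)        ≡⟨ cong (λ t → iter t c (f v)) (m∸n+n≡m p≤) ⟩
    iter (suc M) c (f v)                ≡⟨ c-period (proj₁ (range bf a b)) (proj₂ (range bf a b)) ⟩
    f v                                 ∎)
    where open ≡-Reasoning

end-exponent : ∀ {K p M} → K + p ≡ suc M → p ≡ 1 ⊎ p ≡ suc M → K ≡ 0 ⊎ K ≡ M
end-exponent {K} {M = M} e (inj₁ refl) = inj₂ (+-cancelʳ-≡ 1 K M (trans e (+-comm 1 M)))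
end-exponent {K} {M = M} e (inj₂ refl) = inj₁ (+-cancelʳ-≡ (suc M) K 0 e)

exponent-bound : ∀ {K p M} → K + p ≡ suc M → 1 ≤ p → K ≤ M
exponent-bound {K} e 1≤p = s≤s⁻¹ (subst (K <_) e (m<m+n K 1≤p))

attach : ∀ {m} {k τ : ℕ → ℕ} K → τ (suc (suc m)) ≡ suc (suc m) →
         (∀ v → 1 ≤ v → v ≤ suc m → τ v ≡ cprod k m v) →
         ∀ {v} → 1 ≤ v → v ≤ suc (suc m) →
         iter K (cℕ (suc m)) (τ v) ≡ cprod (setAt k (suc m) K) (suc m) v
attach {m} {k} {τ} K top τ≡ {v} a b =
  trans (cong (iter K (cℕ (suc m))) (τ≡′ (≤-top b))) (sym (cprod-setAt k m K v))
  where
  τ≡′ : v ≤ suc m ⊎ v ≡ suc (suc m) → τ v ≡ cprod k m v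
  τ≡′ (inj₁ v≤) = τ≡ v a v≤
  τ≡′ (inj₂ refl) = trans top (sym (cprod-fix k m (suc (suc m)) ≤-refl))

AdmissibleProduct : ℕ → (ℕ → ℕ) → Set
AdmissibleProduct m τ =
  Σ (ℕ → ℕ) λ k → Admissible m k × (∀ v → 1 ≤ v → v ≤ suc m → τ v ≡ cprod k m v)

-- Cyclic version: a bijection of {1,…,m+2}
-- whose proper prefix images are intervals of ℤ_{m+2} is c_{m+1}^K c_m^{k m} ⋯ c_1^{k 1}
-- with k admissible and K + f (m+2) = m + 2.  Each is proved from the other by peeling.
factorization : ∀ m {τ} → Bijective (suc m) τ →
                (∀ j → 1 ≤ j → j ≤ suc m → LinInterval (suc m) (Img τ j)) → AdmissibleProduct m τ

cyclic-factorization : ∀ m {f} → Bijective (suc (suc m)) f →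
  (∀ j → 1 ≤ j → j ≤ suc m → CycInterval (suc (suc m)) (Img f j)) →
  Σ ℕ λ K → Σ (ℕ → ℕ) λ k → K + f (suc (suc m)) ≡ suc (suc m) × Admissible m k ×
    (∀ v → 1 ≤ v → v ≤ suc (suc m) → f v ≡ cprod (setAt k (suc m) K) (suc m) v)

factorization zero {τ} bτ _ =
  (λ _ → 0) , (λ i 1≤i i≤0 → ⊥-elim (<-irrefl refl (≤-trans 1≤i i≤0))) , fixed
  where
  fixed : ∀ v → 1 ≤ v → v ≤ 1 → τ v ≡ v
  fixed v a b with ≤-antisym b a
  ... | refl = ≤-antisym (proj₂ (range bτ a b)) (proj₁ (range bτ a b))
factorization (suc m) {τ} bτ lin-τ
  with cyclic-factorization m bτ (λ j a b → straight (lin-τ j a (m≤n⇒m≤1+n b)))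
... | K , k , K+p , adm , eq =
  setAt k (suc m) K , admissible-setAt adm (end-exponent K+p p-at-end) , eq
  where
  -- all values but p = τ (m+2) form the interval τ {1,…,m+1}, so p is an end point
  p-range : 1 ≤ τ (suc (suc m)) × τ (suc (suc m)) ≤ suc (suc m)
  p-range = range bτ (s≤s z≤n) ≤-refl
  p-at-end : τ (suc (suc m)) ≡ 1 ⊎ τ (suc (suc m)) ≡ suc (suc m)
  p-at-end = gap-at-end (lin-τ (suc m) (s≤s z≤n) (n≤1+n _)) (img-but-last bτ)
                        (proj₁ p-range) (proj₂ p-range)

cyclic-factorization m {f} bf cyc-f =
  K , k , K+last , adm , λ v a b → trans (f≡cᴷτ a b) (attach {τ = τ} K τ-top τ≡ a b)
  where
  open Peeled (peel bf cyc-f)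
  τ-product : AdmissibleProduct m τ
  τ-product = factorization m τ-bij τ-lin
  k : ℕ → ℕ
  k = proj₁ τ-product
  adm : Admissible m k
  adm = proj₁ (proj₂ τ-product)
  τ≡ : ∀ v → 1 ≤ v → v ≤ suc m → τ v ≡ cprod k m v
  τ≡ = proj₂ (proj₂ τ-product)

toFin : ∀ {n v} → 1 ≤ v → v ≤ n → Σ (Fin n) λ x → val x ≡ v
toFin {v = suc w} _ v≤n = fromℕ< v≤n , cong suc (Fin.toℕ-fromℕ< v≤n)

val-injective : ∀ {n} {x y : Fin n} → val x ≡ val y → x ≡ y
val-injective e = Fin.toℕ-injective (suc-injective e)

val-range : ∀ {n} (x : Fin n) → 1 ≤ val x × val x ≤ n
val-range x = s≤s z≤n , Fin.toℕ<n x

-- The value function i ↦ π(i) of a permutation, extended by 0 outside {1,…,n}.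
values : ∀ {n} → Permutation′ n → ℕ → ℕ
values π zero = 0
values {n} π (suc w) with w <? n
... | yes w<n = val (π ⟨$⟩ʳ fromℕ< w<n)
... | no _ = 0

values-spec : ∀ {n} (π : Permutation′ n) x → val (π ⟨$⟩ʳ x) ≡ values π (val x)
values-spec {n} π x with toℕ x <? n
... | yes x<n = cong (val ∘ (π ⟨$⟩ʳ_)) (sym (Fin.fromℕ<-toℕ x x<n))
... | no x≮n = ⊥-elim (x≮n (Fin.toℕ<n x))

values-bij : ∀ {n} (π : Permutation′ n) → Bijective n (values π)
values-bij {n} π = record { range = rng ; injective = inj ; surjective = surj }
  where
  rng : ∀ {i} → 1 ≤ i → i ≤ n → 1 ≤ values π i × values π i ≤ n
  rng a b with toFin a b
  ... | x , refl rewrite sym (values-spec π x) = val-range (π ⟨$⟩ʳ x)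
  inj : ∀ {i i′} → 1 ≤ i → i ≤ n → 1 ≤ i′ → i′ ≤ n → values π i ≡ values π i′ → i ≡ i′
  inj a b a′ b′ e with toFin a b | toFin a′ b′
  ... | x , refl | x′ , refl = cong val (begin
    x                          ≡⟨ sym (inverseˡ π) ⟩
    π ⟨$⟩ˡ (π ⟨$⟩ʳ x)          ≡⟨ cong (π ⟨$⟩ˡ_) (val-injective (trans (values-spec π x)
                                      (trans e (sym (values-spec π x′))))) ⟩
    π ⟨$⟩ˡ (π ⟨$⟩ʳ x′)         ≡⟨ inverseˡ π ⟩
    x′                         ∎)
    where open ≡-Reasoning
  surj : ∀ {w} → 1 ≤ w → w ≤ n → Img (values π) n w
  surj a b with toFin a b
  ... | y , refl = val (π ⟨$⟩ˡ y) , proj₁ (val-range (π ⟨$⟩ˡ y)) , proj₂ (val-range (π ⟨$⟩ˡ y)) ,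
                   trans (sym (values-spec π (π ⟨$⟩ˡ y))) (cong val (inverseʳ π))

prefix⇔img : ∀ {n g} (π : Permutation′ n) → (∀ x → val (π ⟨$⟩ʳ x) ≡ g (val x)) →
             ∀ {j} → j ≤ n → ∀ y → prefixImage π j y ⇔ Img g j (val y)
prefix⇔img {n} {g} π πg {j} j≤n y = mk⇔
  (λ (x , x≤j , e) → val x , s≤s z≤n , x≤j , trans (sym (πg x)) (cong val e))
  from-img
  where
  from-img : Img g j (val y) → prefixImage π j y
  from-img (i , a , i≤j , e) with toFin a (≤-trans i≤j j≤n)
  ... | x , refl = x , i≤j , val-injective (trans (πg x) e)

fin⇔agree : ∀ {n} {P : Fin n → Set} {S : ℕ → Set} T → (∀ y → P y ⇔ S (val y)) →
            ((∀ y → P y → T (val y)) × (∀ y → T (val y) → P y)) ⇔ Agree n S T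
fin⇔agree {n} {P} {S} T PS =
  mk⇔ agree (λ ag → (λ y p → to (ag′ ag y) (to (PS y) p)) ,
                    (λ y t → from (PS y) (from (ag′ ag y) t)))
  where
  ag′ : Agree n S T → ∀ y → S (val y) ⇔ T (val y)
  ag′ ag y = ag (proj₁ (val-range y)) (proj₂ (val-range y))
  agree : (∀ y → P y → T (val y)) × (∀ y → T (val y) → P y) → Agree n S T
  agree (PT , TP) a b with toFin a b
  ... | x , refl = mk⇔ (λ s → PT x (from (PS x) s)) (λ t → to (PS x) (TP x t))

interval⇔cyc : ∀ {n} {P : Fin n → Set} {S : ℕ → Set} → (∀ y → P y ⇔ S (val y)) →
               IsInterval n P ⇔ CycInterval n S
interval⇔cyc {n} {P} {S} PS = mk⇔
  (λ { (a , b , p , q , r , inj₁ h) → straight (lin a b p q r (to (shape (Between a b)) h))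
     ; (a , b , p , q , r , inj₂ h) → wrapped a b p q r (to (shape (Wrap a b)) h) })
  (λ { (straight (lin a b p q r ag)) → a , b , p , q , r , inj₁ (from (shape (Between a b)) ag)
     ; (wrapped a b p q r ag) → a , b , p , q , r , inj₂ (from (shape (Wrap a b)) ag) })
  where
  shape : ∀ T → ((∀ y → P y → T (val y)) × (∀ y → T (val y) → P y)) ⇔ Agree n S T
  shape T = fin⇔agree T PS

arc⇔cyc : ∀ {n g} (π : Permutation′ n) → (∀ x → val (π ⟨$⟩ʳ x) ≡ g (val x)) →
          IsArc π ⇔ (∀ j → 1 ≤ j → j ≤ n → CycInterval n (Img g j))
arc⇔cyc π πg = mk⇔
  (λ arc j a b → to (interval⇔cyc (prefix⇔img π πg b)) (arc j a b))
  (λ cyc j a b → from (interval⇔cyc (prefix⇔img π πg b)) (cyc j a b))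

arc⇒product : ∀ m (π : Permutation′ (suc (suc m))) → IsArc π →
  Σ (ℕ → ℕ) λ k → (k (suc m) ≤ suc m) × Admissible m k ×
    (∀ (x : Fin (suc (suc m))) → val (π ⟨$⟩ʳ x) ≡ cprod k (suc m) (val x))
arc⇒product m π arc
  with cyclic-factorization m (values-bij π)
         (λ j a b → to (arc⇔cyc π (values-spec π)) arc j a (m≤n⇒m≤1+n b))
... | K , k , K+p , adm , eq =
  setAt k (suc m) K , top-bound , admissible-setAt-below adm ,
  λ x → trans (values-spec π x) (eq (val x) (s≤s z≤n) (Fin.toℕ<n x))
  where
  top-bound : setAt k (suc m) K (suc m) ≤ suc m
  top-bound = subst (_≤ suc m) (sym (setAt-same k (suc m) K))
                (exponent-bound K+p (proj₁ (range (values-bij π) (s≤s z≤n) ≤-refl)))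

product⇒arc : ∀ m (π : Permutation′ (suc (suc m))) (k : ℕ → ℕ) → Admissible m k →
  (∀ (x : Fin (suc (suc m))) → val (π ⟨$⟩ʳ x) ≡ cprod k (suc m) (val x)) → IsArc π
product⇒arc m π k adm πk = from (arc⇔cyc π πk)
  (glue (bij-cprod k m) (cprod-fix k m (suc (suc m)) ≤-refl) (prefix-intervals m adm) (k (suc m)))

proposition5p6 : (n : ℕ) → 2 ≤ n → (π : Permutation′ n) →
    IsArc π ⇔
    (Σ (ℕ → ℕ) λ k →
      (k (n ∸ 1) ≤ n ∸ 1) ×
      (∀ i → 1 ≤ i → i ≤ n ∸ 2 → (k i ≡ 0 ⊎ k i ≡ i)) ×
      (∀ (x : Fin n) → val (π ⟨$⟩ʳ x) ≡ cprod k (n ∸ 1) (val x)))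
proposition5p6 (suc zero) (s≤s ()) π
proposition5p6 (suc (suc m)) _ π =
  mk⇔ (arc⇒product m π) (λ (k , _ , adm , πk) → product⇒arc m π k adm πk)
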